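{- Let $\overline{\mathsf{M}}$ be a complemented HMS model. For any individual $i\in I$ and $\omega,\omega'\in\Omega$: if $\omega'\in\Pi_i(\omega)$, then $\Lambda_i(\omega')=\Pi_i(\omega')$.
   Context: Fix a non-empty set $\mathsf{At}$. A complemented HMS model $\langle I,\{S_\Phi\},(r^\Phi_\Psi),(\Lambda_i),(\Pi_i),v\rangle$: $I\ne\emptyset$; non-empty pairwise disjoint spaces $S_\Phi$ ($\Phi\subseteq\mathsf{At}$), ordered $S_{\Phi'}\succeq S_\Phi$ iff $\Phi\subseteq\Phi'$; $\Omega=\bigcup_\Phi S_\Phi$; surjections $r^\Phi_\Psi:S_\Phi\to S_\Psi$, $r^\Phi_\Phi=\mathrm{id}$, $r^\Phi_\Upsilon=r^\Psi_\Upsilon\circ r^\Phi_\Psi$; $\omega_\Psi=r^\Phi_\Psi(\omega)$; for $D\subseteq S_\Phi$, $D_\Psi=D_{S_\Psi}=r^\Phi_\Psi(D)$, $D^\uparrow=\bigcup_{\Phi\subseteq\Psi}(r^\Psi_\Phi)^{ -1}(D)$; events are sets $D^\uparrow$; $v$ maps atoms to events. $\Pi_i:\Omega\to2^\Omega\setminus\{\emptyset\}$: Confinement ($\omega\in S_\Phi\Rightarrow\Pi_i(\omega)\subseteq S_\Psi$ for some $\Psi\subseteq\Phi$; denoted $S_{\Pi_i(\omega)}$), Generalized Reflexivity ($\omega\in\Pi_i(\omega)^\uparrow$), Stationarity ($\omega'\in\Pi_i(\omega)\Rightarrow\Pi_i(\omega')=\Pi_i(\omega)$), Projections Preserve Ignorance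 ($\omega\in S_\Phi$, $\Psi\subseteq\Phi\Rightarrow\Pi_i(\omega)^\uparrow\subseteq\Pi_i(\omega_\Psi)^\uparrow$), Projections Preserve Knowledge ($\Upsilon\subseteq\Psi\subseteq\Phi$, $\omega\in S_\Phi$, $\Pi_i(\omega)\subseteq S_\Psi\Rightarrow\Pi_i(\omega)_\Upsilon=\Pi_i(\omega_\Upsilon)$). $\Lambda_i:\Omega\to2^\Omega$: Reflexivity ($\omega\in\Lambda_i(\omega)$), Stationarity ($\omega'\in\Lambda_i(\omega)\Rightarrow\Lambda_i(\omega')=\Lambda_i(\omega)$), Projections Preserve Implicit Knowledge ($\omega\in S_\Phi$, $\Psi\subseteq\Phi\Rightarrow\Lambda_i(\omega)_\Psi=\Lambda_i(\omega_\Psi)$), Explicit Measurability ($\omega'\in\Lambda_i(\omega)\Rightarrow\Pi_i(\omega')=\Pi_i(\omega)$), Implicit Measurability ($\omega'\in\Pi_i(\omega)\Rightarrow\Lambda_i(\omega')=\Lambda_i(\omega)_{S_{\Pi_i(\omega)}}$). -}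

module Defs where

open import Level using (0ℓ)
open import Data.Bool using (Bool; true)
open import Data.Product using (Σ; ∃; _×_; _,_; proj₁; proj₂)
open import Relation.Unary using (Pred; _⊆_)
open import Relation.Binary.PropositionalEquality using (_≡_; subst)

Sub : Set → Set
Sub At = At → Bool

_⊑_ : {At : Set} → Sub At → Sub At → Set
Ψ ⊑ Φ = ∀ a → Ψ a ≡ true → Φ a ≡ true

_≐_ : {A : Set} → Pred A 0ℓ → Pred A 0ℓ → Set
X ≐ Y = (X ⊆ Y) × (Y ⊆ X)

record HMS (At : Set) (I : Set) : Set₁ where
  field
    atom₀ : At
    ind₀  : I
    -- the spaces S_Φ (disjointness is built in: Ω is their disjoint union)
    S     : Sub At → Set
    S-ne  : (Φ : Sub At) → S Φ
    r     : {Φ Ψ : Sub At} → Ψ ⊑ Φ → S Φ → S Ψ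
    r-surj : {Φ Ψ : Sub At} (p : Ψ ⊑ Φ) (y : S Ψ) → ∃ λ x → r p x ≡ y
    r-id   : {Φ : Sub At} (p : Φ ⊑ Φ) (x : S Φ) → r p x ≡ x
    r-comp : {Φ Ψ Υ : Sub At} (p : Ψ ⊑ Φ) (q : Υ ⊑ Ψ) (u : Υ ⊑ Φ) (x : S Φ) →
             r u x ≡ r q (r p x)

  Ω : Set
  Ω = Σ (Sub At) S

  emb : (Ψ : Sub At) → Pred (S Ψ) 0ℓ → Pred Ω 0ℓ
  emb Ψ D (Φ' , y) = Σ (Φ' ≡ Ψ) λ e → D (subst S e y)

  proj : {Φ Ψ : Sub At} → Ψ ⊑ Φ → Pred (S Φ) 0ℓ → Pred (S Ψ) 0ℓ
  proj p D y = ∃ λ x → D x × (r p x ≡ y)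

  up : (Φ : Sub At) → Pred (S Φ) 0ℓ → Pred Ω 0ℓ
  up Φ D (Ψ , y) = Σ (Φ ⊑ Ψ) λ p → D (r p y)

  field
    -- valuation: every atom is mapped to an event D^↑
    v      : At → Σ (Sub At) λ Φ → Pred (S Φ) 0ℓ

  -- possibility correspondence Π_i, with Confinement built in:
  -- Π_i(ω) for ω ∈ S_Φ is a non-empty subset of some S_Ψ with Ψ ⊆ Φ.
  field
    Πlev  : I → (ω : Ω) → Sub At
    Πsub  : (i : I) (ω : Ω) → Πlev i ω ⊑ proj₁ ω
    Πset  : (i : I) (ω : Ω) → Pred (S (Πlev i ω)) 0ℓ
    Π-ne  : (i : I) (ω : Ω) → ∃ λ y → Πset i ω y

  Π : I → Ω → Pred Ω 0ℓ
  Π i ω = emb (Πlev i ω) (Πset i ω)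

  Π↑ : I → Ω → Pred Ω 0ℓ
  Π↑ i ω = up (Πlev i ω) (Πset i ω)

  field
    Π-genRefl : (i : I) (ω : Ω) → Π↑ i ω ω
    Π-stat    : (i : I) (ω ω' : Ω) → Π i ω ω' → Π i ω' ≐ Π i ω
    Π-PPI     : (i : I) (Φ Ψ : Sub At) (s : S Φ) (q : Ψ ⊑ Φ) →
                Π↑ i (Φ , s) ⊆ Π↑ i (Ψ , r q s)
    Π-PPK     : (i : I) (Φ Υ : Sub At) (s : S Φ)
                (u : Υ ⊑ Πlev i (Φ , s)) (w : Υ ⊑ Φ) →
                emb Υ (proj u (Πset i (Φ , s))) ≐ Π i (Υ , r w s)

  field
    Λset : I → (ω : Ω) → Pred (S (proj₁ ω)) 0ℓ

  Λ : I → Ω → Pred Ω 0ℓ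
  Λ i ω = emb (proj₁ ω) (Λset i ω)

  field
    Λ-refl  : (i : I) (ω : Ω) → Λ i ω ω
    Λ-stat  : (i : I) (ω ω' : Ω) → Λ i ω ω' → Λ i ω' ≐ Λ i ω
    Λ-PPIK  : (i : I) (Φ Ψ : Sub At) (s : S Φ) (q : Ψ ⊑ Φ) →
              emb Ψ (proj q (Λset i (Φ , s))) ≐ Λ i (Ψ , r q s)
    Λ-explM : (i : I) (ω ω' : Ω) → Λ i ω ω' → Π i ω' ≐ Π i ω
    Λ-implM : (i : I) (ω : Ω) (y : S (Πlev i ω)) → Πset i ω y →
              Λ i (Πlev i ω , y) ≐ emb (Πlev i ω) (proj (Πsub i ω) (Λset i ω))

module Submission where

open import Defs
open import Data.Product using (_,_; proj₁; proj₂)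
open import Relation.Unary using (_⊆_)
open import Relation.Unary.Properties using (≐-sym; ≐-trans)
open import Relation.Binary.PropositionalEquality using (_≡_; refl; trans; subst)

-- By Implicit Measurability, Λ_i(ω') for ω' ∈ Π_i(ω) is the restriction of Λ_i(ω) to the
-- level of Π_i(ω).  That restriction is exactly Π_i(ω): every state ω'' of Λ_i(ω) has
-- Π_i(ω'') = Π_i(ω) (Explicit Measurability) and, by Generalized Reflexivity, projects into
-- Π_i(ω''); conversely Λ_i is reflexive.  Stationarity of Π_i finishes the argument.

module _ {At I : Set} (M : HMS At I) where
  open HMS M

  ⊑-refl : {Φ : Sub At} → Φ ⊑ Φ
  ⊑-refl _ h = h

  -- The inclusion proof is not irrelevant by itself; r-comp factors r p through r p' and the identity.
  r-irrelevant : {Φ Ψ : Sub At} (p p' : Ψ ⊑ Φ) (x : S Φ) → r p x ≡ r p' x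
  r-irrelevant p p' x = trans (r-comp p' ⊑-refl p x) (r-id ⊑-refl (r p' x))

  subst-r : {Φ Ψ₁ Ψ₂ : Sub At} (e : Ψ₁ ≡ Ψ₂) (p : Ψ₁ ⊑ Φ) (p' : Ψ₂ ⊑ Φ) (x : S Φ) →
            subst S e (r p x) ≡ r p' x
  subst-r refl = r-irrelevant

  Λ-restricted-to-Π≐Π : (i : I) (ω : Ω) →
                        emb (Πlev i ω) (proj (Πsub i ω) (Λset i ω)) ≐ Π i ω
  Λ-restricted-to-Π≐Π i ω@(Φ , _) = restriction⊆Π , Π⊆restriction
    where
    restriction⊆Π : emb (Πlev i ω) (proj (Πsub i ω) (Λset i ω)) ⊆ Π i ω
    restriction⊆Π {_ , z} (refl , x , x∈Λω , rx≡z) =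
      refl , subst (Πset i ω) (trans (subst-r (proj₁ rx∈Πω) (proj₁ reflexive) (Πsub i ω) x) rx≡z)
                                (proj₂ rx∈Πω)
      where
      reflexive : Π↑ i (Φ , x) (Φ , x)
      reflexive = Π-genRefl i (Φ , x)
      rx∈Πω : Π i ω (Πlev i (Φ , x) , r (proj₁ reflexive) x)
      rx∈Πω = proj₁ (Λ-explM i ω (Φ , x) (refl , x∈Λω)) (refl , proj₂ reflexive)

    Π⊆restriction : Π i ω ⊆ emb (Πlev i ω) (proj (Πsub i ω) (Λset i ω))
    Π⊆restriction {_ , z} (refl , z∈Πω) = proj₁ (Λ-implM i ω z z∈Πω) (Λ-refl i (Πlev i ω , z))

lemma4 : {At I : Set} (M : HMS At I) → let open HMS M in
         (i : I) (ω ω' : Ω) → Π i ω ω' → Λ i ω' ≐ Π i ω'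
lemma4 M i ω (_ , y) ω'∈Πω@(refl , y∈Πω) =
  ≐-trans (Λ-implM i ω y y∈Πω)
    (≐-trans (Λ-restricted-to-Π≐Π M i ω) (≐-sym (Π-stat i ω (Πlev i ω , y) ω'∈Πω)))
  where open HMS M
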